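{- Let $\mathcal{Q}$ be a quasi-crystal of type $A_{n-1}$ satisfying axioms LQ1 and LQ2. Let $i,j\in I$ and $x,y\in\mathcal{Q}$ with $\ddot e_i(x)=y$. Then: (1) if $|i-j|>1$, then $\ddot\varepsilon_j(y)=\ddot\varepsilon_j(x)$ if and only if $\ddot\varphi_j(y)=\ddot\varphi_j(x)$; (2) if $i+1\in I$ and $\ddot\varepsilon_{i+1}(x)\neq+\infty$, then $\ddot\varepsilon_{i+1}(y)=\ddot\varepsilon_{i+1}(x)$ if and only if $\ddot\varphi_{i+1}(y)=\ddot\varphi_{i+1}(x)-1$; (3) if $i-1\in I$ and $\ddot\varepsilon_{i-1}(x)\neq+\infty$, then $\ddot\varepsilon_{i-1}(y)=\ddot\varepsilon_{i-1}(x)+1$ if and only if $\ddot\varphi_{i-1}(y)=\ddot\varphi_{i-1}(x)$.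
   Context: Fix $n\ge 2$, $I=\{1,\dots,n-1\}$, weights in $\mathbb{Z}^n$ with standard inner product, $\alpha_i=\mathbf{e}_i-\mathbf{e}_{i+1}$; on $\mathbb{Z}\sqcup\{\pm\infty\}$, $m+(\pm\infty)=\pm\infty$. A quasi-crystal of type $A_{n-1}$ is a non-empty set $\mathcal{Q}$ with maps $\ddot e_i,\ddot f_i:\mathcal{Q}\to\mathcal{Q}\sqcup\{\bot\}$, $\ddot\varepsilon_i,\ddot\varphi_i:\mathcal{Q}\to\mathbb{Z}\sqcup\{\pm\infty\}$, $\mathrm{wt}:\mathcal{Q}\to\mathbb{Z}^n$ with: (Q1) $\ddot e_i(x)=y\iff x=\ddot f_i(y)$, and then $\mathrm{wt}(y)=\mathrm{wt}(x)+\alpha_i$, $\ddot\varepsilon_i(y)=\ddot\varepsilon_i(x)-1$, $\ddot\varphi_i(y)=\ddot\varphi_i(x)+1$; (Q2) $\ddot\varphi_i(x)=\ddot\varepsilon_i(x)+\langle\mathrm{wt}(x),\alpha_i\rangle$; (Q3),(Q4) if $\ddot\varepsilon_i(x)=\pm\infty$ then $\ddot e_i(x)=\ddot f_i(x)=\bot$. Axioms (all $i,j\in I$, $x,y$): (LQ1) for $i+1\in I$: $\ddot\varepsilon_i(x)=0\iff\ddot\varphi_{i+1}(x)=0$. (LQ2) if $\ddot e_i(x)=y$: (1) $\ddot\varepsilon_j(x)=\ddot\varepsilon_j(y)$ for $|i-j|>1$; (2) if $i+1\in I$: $\ddot\varepsilon_{i+1}(x)\ne\ddot\varepsilon_{i+1}(y)$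 iff ($\ddot\varepsilon_{i+1}(x)=+\infty$ and $\ddot\varepsilon_i(y)=0$), and then $\ddot\varepsilon_{i+1}(y)\ne0$; (3) if $i-1\in I$: $\ddot\varphi_{i-1}(x)\ne\ddot\varphi_{i-1}(y)$ iff ($\ddot\varphi_{i-1}(y)=+\infty$ and $\ddot\varphi_i(x)=0$), and then $\ddot\varphi_{i-1}(x)\ne0$. -}

module Defs where

open import Data.Nat as ℕ using (ℕ; zero; suc; _<_; _≤_)
open import Data.Integer as ℤ using (ℤ; +_; -[1+_])
open import Data.Fin using (Fin; toℕ)
open import Data.Vec using (Vec; tabulate; zipWith; foldr)
open import Data.Maybe using (Maybe; just; nothing)
open import Data.Product using (_×_; _,_)
open import Data.Sum using (_⊎_)
open import Relation.Binary.PropositionalEquality using (_≡_; _≢_)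
open import Relation.Nullary using (¬_)
open import Function.Bundles using (_⇔_)

data ℤ∞ : Set where
  fin : ℤ → ℤ∞
  +∞  : ℤ∞
  -∞  : ℤ∞

infixl 6 _⊕_
_⊕_ : ℤ∞ → ℤ → ℤ∞
fin a ⊕ m = fin (a ℤ.+ m)
+∞    ⊕ m = +∞
-∞    ⊕ m = -∞

-- Weights: ℤ^n as Vec ℤ n; indices of I = {1,…,n-1} are natural numbers i
-- with 1 ≤ i < n; coordinate k (1-based) is position k-1 of the vector.
Weight : ℕ → Set
Weight n = Vec ℤ n

basis : (n k : ℕ) → Weight n
basis n k = tabulate (λ (p : Fin n) → if-eq (suc (toℕ p)) k)
  where
  if-eq : ℕ → ℕ → ℤ
  if-eq a b with a ℕ.≟ b
  ... | Relation.Nullary.yes _ = + 1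
  ... | Relation.Nullary.no  _ = + 0

_+ᵥ_ : ∀ {n} → Weight n → Weight n → Weight n
_+ᵥ_ = zipWith ℤ._+_

_-ᵥ_ : ∀ {n} → Weight n → Weight n → Weight n
_-ᵥ_ = zipWith ℤ._-_

α : (n i : ℕ) → Weight n
α n i = basis n i -ᵥ basis n (suc i)

⟨_,_⟩ : ∀ {n} → Weight n → Weight n → ℤ
⟨ u , v ⟩ = foldr _ ℤ._+_ (+ 0) (zipWith ℤ._*_ u v)

InI : ℕ → ℕ → Set
InI n i = 1 ≤ i × i < n

-- Quasi-crystal of type A_{n-1}. The maps are given for every natural
-- index i, but all axioms are only imposed for i ∈ I (values outside I are
-- irrelevant). ⊥ is represented by `nothing`.
record QuasiCrystal (n : ℕ) : Set₁ where
  field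
    Q         : Set
    inhabited : Q
    e f       : ℕ → Q → Maybe Q
    ε φ       : ℕ → Q → ℤ∞
    wt        : Q → Weight n
    Q1-ef  : ∀ i → InI n i → ∀ x y → (e i x ≡ just y) ⇔ (f i y ≡ just x)
    Q1-wt  : ∀ i → InI n i → ∀ x y → e i x ≡ just y → wt y ≡ wt x +ᵥ α n i
    Q1-ε   : ∀ i → InI n i → ∀ x y → e i x ≡ just y → ε i y ≡ ε i x ⊕ -[1+ 0 ]
    Q1-φ   : ∀ i → InI n i → ∀ x y → e i x ≡ just y → φ i y ≡ φ i x ⊕ + 1
    Q2     : ∀ i → InI n i → ∀ x → φ i x ≡ ε i x ⊕ ⟨ wt x , α n i ⟩
    Q3     : ∀ i → InI n i → ∀ x → ε i x ≡ +∞ → (e i x ≡ nothing × f i x ≡ nothing)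
    Q4     : ∀ i → InI n i → ∀ x → ε i x ≡ -∞ → (e i x ≡ nothing × f i x ≡ nothing)

FarApart : ℕ → ℕ → Set
FarApart i j = suc i < j ⊎ suc j < i

record SatisfiesLQ {n : ℕ} (C : QuasiCrystal n) : Set where
  open QuasiCrystal C
  field
    LQ1   : ∀ i → InI n i → InI n (suc i) → ∀ x →
            (ε i x ≡ fin (+ 0)) ⇔ (φ (suc i) x ≡ fin (+ 0))
    LQ2-1 : ∀ i j → InI n i → InI n j → ∀ x y → e i x ≡ just y →
            FarApart i j → ε j x ≡ ε j y
    LQ2-2 : ∀ i → InI n i → InI n (suc i) → ∀ x y → e i x ≡ just y →
            ((ε (suc i) x ≢ ε (suc i) y) ⇔ (ε (suc i) x ≡ +∞ × ε i y ≡ fin (+ 0)))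
            × (ε (suc i) x ≢ ε (suc i) y → ε (suc i) y ≢ fin (+ 0))
    LQ2-3 : ∀ i → InI n i → InI n (i ℕ.∸ 1) → ∀ x y → e i x ≡ just y →
            ((φ (i ℕ.∸ 1) x ≢ φ (i ℕ.∸ 1) y) ⇔ (φ (i ℕ.∸ 1) y ≡ +∞ × φ i x ≡ fin (+ 0)))
            × (φ (i ℕ.∸ 1) x ≢ φ (i ℕ.∸ 1) y → φ (i ℕ.∸ 1) x ≢ fin (+ 0))

{-# OPTIONS --safe #-}
-- By (Q1), wt y = wt x + α_i, so (Q2) turns a shift of ε_k by c into a shift of φ_k by
-- c + ⟨α_i, α_k⟩, and conversely, because translation by an integer is injective on
-- ℤ ⊔ {±∞}.  The three parts are the Cartan entries ⟨α_i, α_j⟩ = 0 for |i − j| > 1 and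
-- ⟨α_i, α_{i±1}⟩ = −1.
module Submission where

open import Defs
open import Data.Nat as ℕ using (ℕ; zero; suc; _≤_; _<_; _∸_)
import Data.Nat.Properties as ℕP
open import Data.Integer as ℤ using (ℤ; +_; -[1+_])
import Data.Integer.Properties as ℤP
open import Algebra.Properties.AbelianGroup ℤP.+-0-abelianGroup using (∙-cancelʳ)
open import Algebra.Properties.CommutativeSemigroup ℤP.+-commutativeSemigroup
  using (interchange; x∙yz≈y∙xz)
open import Data.Fin as Fin using (Fin; toℕ; fromℕ<)
open import Data.Fin.Properties using (toℕ-fromℕ<; toℕ-injective; suc-injective)
open import Data.Vec using (Vec; []; _∷_; lookup; tabulate)
open import Data.Vec.Properties using (lookup∘tabulate; lookup-zipWith)
open import Data.Maybe using (just)
open import Data.Product using (_×_; _,_; proj₁; proj₂)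
open import Data.Sum using (inj₁; inj₂)
open import Function using (_∘_)
open import Function.Bundles using (_⇔_; mk⇔)
open import Function.Properties.Equivalence using () renaming (trans to ⇔-trans; sym to ⇔-sym)
open import Relation.Binary.PropositionalEquality
open import Relation.Nullary using (yes; no; contradiction)

δ : ℕ → ℕ → ℤ
δ zero    zero    = + 1
δ zero    (suc _) = + 0
δ (suc _) zero    = + 0
δ (suc a) (suc b) = δ a b

δ-diag : ∀ a → δ a a ≡ + 1
δ-diag zero    = refl
δ-diag (suc a) = δ-diag a

δ-≢ : ∀ {a b} → a ≢ b → δ a b ≡ + 0
δ-≢ {zero}  {zero}  a≢b = contradiction refl a≢b
δ-≢ {zero}  {suc b} _   = refl
δ-≢ {suc a} {zero}  _   = refl
δ-≢ {suc a} {suc b} a≢b = δ-≢ (a≢b ∘ cong suc)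

lookup-tabulate : ∀ {n} {v : Vec ℤ n} {f} → v ≡ tabulate f → ∀ p → lookup v p ≡ f p
lookup-tabulate refl = lookup∘tabulate _

lookup-basis : ∀ n k (p : Fin n) → lookup (basis n k) p ≡ δ (suc (toℕ p)) k
-- basis compares indices by a local with on ℕ._≟_; unfolding the lookup first lets
-- the with below abstract over that comparison.
lookup-basis n k p rewrite lookup-tabulate {v = basis n k} refl p with suc (toℕ p) ℕ.≟ k
... | yes refl = sym (δ-diag (suc (toℕ p)))
... | no  p≢k  = sym (δ-≢ p≢k)

α-coord : ℕ → ℕ → ℤ
α-coord i a = δ a i ℤ.- δ a (suc i)

lookup-α : ∀ n i (p : Fin n) → lookup (α n i) p ≡ α-coord i (suc (toℕ p))
lookup-α n i p = trans (lookup-zipWith ℤ._-_ p (basis n i) (basis n (suc i)))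
                       (cong₂ ℤ._-_ (lookup-basis n i p) (lookup-basis n (suc i) p))

α-coord-≡0 : ∀ {i a} → a ≢ i → a ≢ suc i → α-coord i a ≡ + 0
α-coord-≡0 a≢i a≢1+i rewrite δ-≢ a≢i | δ-≢ a≢1+i = refl

α-coord-orthogonal : ∀ {i j} → suc i < j → ∀ a → α-coord i a ℤ.* α-coord j a ≡ + 0
α-coord-orthogonal {i} {j} 1+i<j a with a ℕ.<? j
... | yes a<j = trans (cong (α-coord i a ℤ.*_) (α-coord-≡0 (ℕP.<⇒≢ a<j) (ℕP.<⇒≢ (ℕP.m<n⇒m<1+n a<j))))
                      (ℤP.*-zeroʳ (α-coord i a))
... | no  a≮j = trans (cong (ℤ._* α-coord j a) (α-coord-≡0 (ℕP.>⇒≢ i<a) (ℕP.>⇒≢ 1+i<a)))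
                      (ℤP.*-zeroˡ (α-coord j a))
  where
  1+i<a : suc i < a
  1+i<a = ℕP.<-≤-trans 1+i<j (ℕP.≮⇒≥ a≮j)
  i<a : i < a
  i<a = ℕP.<-trans (ℕP.n<1+n i) 1+i<a

α-coord-far : ∀ {i j} → FarApart i j → ∀ a → α-coord i a ℤ.* α-coord j a ≡ + 0
α-coord-far (inj₁ 1+i<j) a = α-coord-orthogonal 1+i<j a
α-coord-far (inj₂ 1+j<i) a = trans (ℤP.*-comm (α-coord _ a) _) (α-coord-orthogonal 1+j<i a)

α-coord-adjacent : ∀ i a → a ≢ suc i → α-coord i a ℤ.* α-coord (suc i) a ≡ + 0
α-coord-adjacent i a a≢1+i with a ℕ.≟ i
... | yes refl = trans (cong (α-coord a a ℤ.*_) (α-coord-≡0 (ℕP.<⇒≢ a<1+a) (ℕP.<⇒≢ (ℕP.m<n⇒m<1+n a<1+a))))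
                       (ℤP.*-zeroʳ (α-coord a a))
  where
  a<1+a : a < suc a
  a<1+a = ℕP.n<1+n a
... | no  a≢i  = trans (cong (ℤ._* α-coord (suc i) a) (α-coord-≡0 a≢i a≢1+i))
                       (ℤP.*-zeroˡ (α-coord (suc i) a))

α-coord-shared : ∀ i → α-coord i (suc i) ℤ.* α-coord (suc i) (suc i) ≡ -[1+ 0 ]
α-coord-shared i rewrite δ-≢ (ℕP.1+n≢n {i}) | δ-diag i | δ-≢ (ℕP.<⇒≢ (ℕP.n<1+n i)) = refl

⟨⟩-comm : ∀ {n} (u v : Vec ℤ n) → ⟨ u , v ⟩ ≡ ⟨ v , u ⟩
⟨⟩-comm []      []      = refl
⟨⟩-comm (a ∷ u) (b ∷ v) = cong₂ ℤ._+_ (ℤP.*-comm a b) (⟨⟩-comm u v)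

⟨⟩-distribʳ-+ᵥ : ∀ {n} (u v w : Vec ℤ n) → ⟨ u +ᵥ v , w ⟩ ≡ ⟨ u , w ⟩ ℤ.+ ⟨ v , w ⟩
⟨⟩-distribʳ-+ᵥ []      []      []      = refl
⟨⟩-distribʳ-+ᵥ (a ∷ u) (b ∷ v) (c ∷ w) = begin
  (a ℤ.+ b) ℤ.* c ℤ.+ ⟨ u +ᵥ v , w ⟩
    ≡⟨ cong₂ ℤ._+_ (ℤP.*-distribʳ-+ c a b) (⟨⟩-distribʳ-+ᵥ u v w) ⟩
  (a ℤ.* c ℤ.+ b ℤ.* c) ℤ.+ (⟨ u , w ⟩ ℤ.+ ⟨ v , w ⟩)
    ≡⟨ interchange (a ℤ.* c) (b ℤ.* c) ⟨ u , w ⟩ ⟨ v , w ⟩ ⟩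
  (a ℤ.* c ℤ.+ ⟨ u , w ⟩) ℤ.+ (b ℤ.* c ℤ.+ ⟨ v , w ⟩) ∎
  where open ≡-Reasoning

⟨⟩-orthogonal : ∀ {n} (u v : Vec ℤ n) →
  (∀ p → lookup u p ℤ.* lookup v p ≡ + 0) → ⟨ u , v ⟩ ≡ + 0
⟨⟩-orthogonal []      []      _  = refl
⟨⟩-orthogonal (a ∷ u) (b ∷ v) uv = cong₂ ℤ._+_ (uv Fin.zero) (⟨⟩-orthogonal u v (uv ∘ Fin.suc))

⟨⟩-single : ∀ {n} (u v : Vec ℤ n) q →
  (∀ p → p ≢ q → lookup u p ℤ.* lookup v p ≡ + 0) → ⟨ u , v ⟩ ≡ lookup u q ℤ.* lookup v q
⟨⟩-single (a ∷ u) (b ∷ v) Fin.zero uv =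
  trans (cong (ℤ._+_ (a ℤ.* b)) (⟨⟩-orthogonal u v (λ p → uv (Fin.suc p) λ ())))
        (ℤP.+-identityʳ (a ℤ.* b))
⟨⟩-single (a ∷ u) (b ∷ v) (Fin.suc q) uv =
  trans (cong₂ ℤ._+_ (uv Fin.zero λ ()) (⟨⟩-single u v q (λ p p≢q → uv (Fin.suc p) (p≢q ∘ suc-injective))))
        (ℤP.+-identityˡ _)

lookup-α*α : ∀ n i j (p : Fin n) →
  lookup (α n i) p ℤ.* lookup (α n j) p ≡ α-coord i (suc (toℕ p)) ℤ.* α-coord j (suc (toℕ p))
lookup-α*α n i j p = cong₂ ℤ._*_ (lookup-α n i p) (lookup-α n j p)

⟨α,α⟩-far : ∀ n {i j} → FarApart i j → ⟨ α n i , α n j ⟩ ≡ + 0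
⟨α,α⟩-far n {i} {j} far = ⟨⟩-orthogonal (α n i) (α n j)
  (λ p → trans (lookup-α*α n i j p) (α-coord-far far (suc (toℕ p))))

⟨α,α⟩-adjacent : ∀ n {i} → i < n → ⟨ α n i , α n (suc i) ⟩ ≡ -[1+ 0 ]
⟨α,α⟩-adjacent n {i} i<n = begin
  ⟨ α n i , α n (suc i) ⟩                             ≡⟨ ⟨⟩-single (α n i) (α n (suc i)) q off-q ⟩
  lookup (α n i) q ℤ.* lookup (α n (suc i)) q         ≡⟨ lookup-α*α n i (suc i) q ⟩
  α-coord i (suc (toℕ q)) ℤ.* α-coord (suc i) (suc (toℕ q))
    ≡⟨ cong (λ a → α-coord i (suc a) ℤ.* α-coord (suc i) (suc a)) (toℕ-fromℕ< i<n) ⟩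
  α-coord i (suc i) ℤ.* α-coord (suc i) (suc i)       ≡⟨ α-coord-shared i ⟩
  -[1+ 0 ]                                            ∎
  where
  open ≡-Reasoning
  q : Fin n
  q = fromℕ< i<n
  off-q : ∀ p → p ≢ q → lookup (α n i) p ℤ.* lookup (α n (suc i)) p ≡ + 0
  off-q p p≢q = trans (lookup-α*α n i (suc i) p) (α-coord-adjacent i (suc (toℕ p)) (p≢q ∘ toℕ≡i))
    where
    toℕ≡i : suc (toℕ p) ≡ suc i → p ≡ q
    toℕ≡i eq = toℕ-injective (trans (ℕP.suc-injective eq) (sym (toℕ-fromℕ< i<n)))

⟨α,α⟩-preceding : ∀ n {i} → 1 ≤ i ∸ 1 → i < n → ⟨ α n i , α n (i ∸ 1) ⟩ ≡ -[1+ 0 ]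
⟨α,α⟩-preceding n {suc (suc k)} _ i<n =
  trans (⟨⟩-comm (α n (suc (suc k))) (α n (suc k))) (⟨α,α⟩-adjacent n (ℕP.<⇒≤ i<n))

⊕-identityʳ : ∀ e → e ⊕ + 0 ≡ e
⊕-identityʳ (fin a) = cong fin (ℤP.+-identityʳ a)
⊕-identityʳ +∞      = refl
⊕-identityʳ -∞      = refl

⊕-assoc : ∀ e a b → (e ⊕ a) ⊕ b ≡ e ⊕ (a ℤ.+ b)
⊕-assoc (fin c) a b = cong fin (ℤP.+-assoc c a b)
⊕-assoc +∞      a b = refl
⊕-assoc -∞      a b = refl

fin-injective : ∀ {a b} → fin a ≡ fin b → a ≡ b
fin-injective refl = refl

⊕-cancelʳ : ∀ {e e′} a → e ⊕ a ≡ e′ ⊕ a → e ≡ e′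
⊕-cancelʳ {fin b} {fin c} a eq = cong fin (∙-cancelʳ a b c (fin-injective eq))
⊕-cancelʳ {+∞}    {+∞}    _ _  = refl
⊕-cancelʳ { -∞}   { -∞}   _ _  = refl
⊕-cancelʳ {fin _} {+∞}    _ ()
⊕-cancelʳ {fin _} { -∞}   _ ()
⊕-cancelʳ {+∞}    {fin _} _ ()
⊕-cancelʳ {+∞}    { -∞}   _ ()
⊕-cancelʳ { -∞}   {fin _} _ ()
⊕-cancelʳ { -∞}   {+∞}    _ ()

≡-⊕-identityʳ : ∀ {d} e → (d ≡ e ⊕ + 0) ⇔ (d ≡ e)
≡-⊕-identityʳ e = mk⇔ (λ eq → trans eq (⊕-identityʳ e)) (λ eq → trans eq (sym (⊕-identityʳ e)))

module _ {n} (C : QuasiCrystal n) where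
  open QuasiCrystal C

  ⟨wt,α⟩-e : ∀ {i x y} → InI n i → e i x ≡ just y →
    ∀ k → ⟨ wt y , α n k ⟩ ≡ ⟨ wt x , α n k ⟩ ℤ.+ ⟨ α n i , α n k ⟩
  ⟨wt,α⟩-e {i} {x} {y} i∈I eᵢx≡y k =
    trans (cong (λ w → ⟨ w , α n k ⟩) (Q1-wt i i∈I x y eᵢx≡y)) (⟨⟩-distribʳ-+ᵥ (wt x) (α n i) (α n k))

  ε-shift⇔φ-shift : ∀ {i k x y} → InI n i → InI n k → e i x ≡ just y →
    ∀ {c c′} → c ℤ.+ ⟨ α n i , α n k ⟩ ≡ c′ →
    (ε k y ≡ ε k x ⊕ c) ⇔ (φ k y ≡ φ k x ⊕ c′)
  ε-shift⇔φ-shift {i} {k} {x} {y} i∈I k∈I eᵢx≡y {c} {c′} c+d≡c′ =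
    mk⇔ (λ eq → trans φy (trans (cong (_⊕ (P ℤ.+ d)) eq) (sym φx)))
        (λ eq → ⊕-cancelʳ (P ℤ.+ d) (trans (sym φy) (trans eq φx)))
    where
    open ≡-Reasoning
    P d : ℤ
    P = ⟨ wt x , α n k ⟩
    d = ⟨ α n i , α n k ⟩
    φy : φ k y ≡ ε k y ⊕ (P ℤ.+ d)
    φy = trans (Q2 k k∈I y) (cong (ε k y ⊕_) (⟨wt,α⟩-e i∈I eᵢx≡y k))
    φx : φ k x ⊕ c′ ≡ (ε k x ⊕ c) ⊕ (P ℤ.+ d)
    φx = begin
      φ k x ⊕ c′                  ≡⟨ cong (_⊕ c′) (Q2 k k∈I x) ⟩
      (ε k x ⊕ P) ⊕ c′            ≡⟨ ⊕-assoc (ε k x) P c′ ⟩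
      ε k x ⊕ (P ℤ.+ c′)          ≡⟨ cong (λ m → ε k x ⊕ (P ℤ.+ m)) (sym c+d≡c′) ⟩
      ε k x ⊕ (P ℤ.+ (c ℤ.+ d))   ≡⟨ cong (ε k x ⊕_) (x∙yz≈y∙xz P c d) ⟩
      ε k x ⊕ (c ℤ.+ (P ℤ.+ d))   ≡⟨ sym (⊕-assoc (ε k x) c (P ℤ.+ d)) ⟩
      (ε k x ⊕ c) ⊕ (P ℤ.+ d)     ∎

lemma3p3 : (n : ℕ) → 2 ≤ n → (C : QuasiCrystal n) → SatisfiesLQ C →
    ∀ i j → InI n i → InI n j → ∀ x y → QuasiCrystal.e C i x ≡ just y →
    (FarApart i j →
      (QuasiCrystal.ε C j y ≡ QuasiCrystal.ε C j x) ⇔ (QuasiCrystal.φ C j y ≡ QuasiCrystal.φ C j x))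
    × (InI n (suc i) → QuasiCrystal.ε C (suc i) x ≢ +∞ →
      (QuasiCrystal.ε C (suc i) y ≡ QuasiCrystal.ε C (suc i) x)
        ⇔ (QuasiCrystal.φ C (suc i) y ≡ QuasiCrystal.φ C (suc i) x ⊕ -[1+ 0 ]))
    × (InI n (i ∸ 1) → QuasiCrystal.ε C (i ∸ 1) x ≢ +∞ →
      (QuasiCrystal.ε C (i ∸ 1) y ≡ QuasiCrystal.ε C (i ∸ 1) x ⊕ + 1)
        ⇔ (QuasiCrystal.φ C (i ∸ 1) y ≡ QuasiCrystal.φ C (i ∸ 1) x))
lemma3p3 n _ C _ i j i∈I j∈I x y eᵢx≡y = far , next , previous
  where
  open QuasiCrystal C

  far : FarApart i j → (ε j y ≡ ε j x) ⇔ (φ j y ≡ φ j x)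
  far i≁j = ⇔-trans (⇔-sym (≡-⊕-identityʳ (ε j x)))
    (⇔-trans (ε-shift⇔φ-shift C i∈I j∈I eᵢx≡y 0+d≡0) (≡-⊕-identityʳ (φ j x)))
    where
    0+d≡0 : + 0 ℤ.+ ⟨ α n i , α n j ⟩ ≡ + 0
    0+d≡0 = trans (ℤP.+-identityˡ _) (⟨α,α⟩-far n i≁j)

  next : InI n (suc i) → ε (suc i) x ≢ +∞ →
    (ε (suc i) y ≡ ε (suc i) x) ⇔ (φ (suc i) y ≡ φ (suc i) x ⊕ -[1+ 0 ])
  next i+1∈I _ = ⇔-trans (⇔-sym (≡-⊕-identityʳ (ε (suc i) x)))
    (ε-shift⇔φ-shift C i∈I i+1∈I eᵢx≡y 0+d≡-1)
    where
    0+d≡-1 : + 0 ℤ.+ ⟨ α n i , α n (suc i) ⟩ ≡ -[1+ 0 ]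
    0+d≡-1 = trans (ℤP.+-identityˡ _) (⟨α,α⟩-adjacent n (ℕP.<⇒≤ (proj₂ i+1∈I)))

  previous : InI n (i ∸ 1) → ε (i ∸ 1) x ≢ +∞ →
    (ε (i ∸ 1) y ≡ ε (i ∸ 1) x ⊕ + 1) ⇔ (φ (i ∸ 1) y ≡ φ (i ∸ 1) x)
  previous i-1∈I _ = ⇔-trans (ε-shift⇔φ-shift C i∈I i-1∈I eᵢx≡y 1+d≡0)
    (≡-⊕-identityʳ (φ (i ∸ 1) x))
    where
    1+d≡0 : + 1 ℤ.+ ⟨ α n i , α n (i ∸ 1) ⟩ ≡ + 0
    1+d≡0 = cong (ℤ._+_ (+ 1)) (⟨α,α⟩-preceding n (proj₁ i-1∈I) (proj₂ i∈I))
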